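{- Let $n\geq 2$ and let $\pi,\tau\in B_n$ have the same first window entry $q\in[\pm n]$. Then $d(\pi,\tau)=3$ if and only if $\tau=\pi r_j r_i r_j$ for some $1\leq i<j\leq n$, where, writing $\pi=[ABC]$ as a concatenation of consecutive substrings with $|A|=j-i$, $|B|=i$ and $|C|\geq 0$, one has $\tau=[A\overline{B}C]$.
   Context: Signed permutations of $[\pm n]=\{ -n,\dots,-1,1,\dots,n\}$ are bijections $w$ with $w(-i)=-w(i)$, written in window notation $[w(1)\cdots w(n)]$, with $\underline{i}=-i$; $B_n$ is their group. For $1\leq i\leq n$, $w r_i=[\underline{w(i)}\cdots\underline{w(1)}\,w(i+1)\cdots w(n)]$. The burnt pancake graph $BP_n$ has vertex set $B_n$ and edges $\{w,wr_i\}$ for $w\in B_n$, $1\leq i\leq n$. $d(\pi,\tau)$ is the length of a shortest $\pi$–$\tau$ path in $BP_n$. Window notations are decomposed into consecutive substrings written with capital letters, e.g. $\pi=[ABC]$; $|X|$ is the length of substring $X$, and for $X=[x_1\cdots x_m]$, $\overline{X}=[\underline{x_m}\cdots\underline{x_1}]$. -}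

module Defs where

open import Data.Nat using (ℕ; zero; suc; _≤_; _<_; _∸_)
open import Data.Integer using (ℤ; -_; ∣_∣)
open import Data.List using (List; []; _∷_; map; reverse; take; drop; _++_; length)
open import Data.List.Relation.Unary.All using (All)
open import Data.List.Relation.Unary.Unique.Propositional using (Unique)
open import Data.Product using (_×_; ∃; ∃-syntax; _,_)
open import Data.Sum using (_⊎_)
open import Relation.Binary.PropositionalEquality using (_≡_)
open import Relation.Nullary using (¬_)

-- A signed permutation w ∈ B_n is represented by its window notation
-- [w(1) ⋯ w(n)] : a list of n integers whose absolute values are a
-- permutation of 1..n (entries nonzero, bounded by n, distinct in absolute value).
Window : Set
Window = List ℤ

InB : ℕ → Window → Set
InB n w = length w ≡ n × All (λ x → 1 ≤ ∣ x ∣ × ∣ x ∣ ≤ n) w × Unique (map ∣_∣ w)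

bar : Window → Window
bar X = map -_ (reverse X)

r : ℕ → Window → Window
r i w = bar (take i w) ++ drop i w

Adj : ℕ → Window → Window → Set
Adj n w u = ∃[ i ] (1 ≤ i × i ≤ n × (u ≡ r i w ⊎ w ≡ r i u))

data Walk (n : ℕ) : Window → Window → ℕ → Set where
  here : ∀ {w} → InB n w → Walk n w w 0
  step : ∀ {w u v k} → InB n w → Adj n w u → Walk n u v k → Walk n w v (suc k)

Dist : ℕ → Window → Window → ℕ → Set
Dist n π τ k = Walk n π τ k × (∀ m → m < k → ¬ Walk n π τ m)

module Submission where

-- Everything rests on one observation about a single flip: w r_c begins
-- with -w(c), and the entries of a signed permutation are distinct in
-- absolute value.  So if w r_c begins with an entry of the same absolute
-- value as the entry z at position p of w, then c = p and that first entry
-- is -z ('flip-head-position').  Consequences, for π with first entry y: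
--   * a flip always changes the first entry, so no walk of length 1 joins
--     π and τ;
--   * after a flip r_a the entry -y sits at position a, so a second flip
--     restoring y to the front is r_a again, and walks of length 2 lead
--     back to π;
--   * for three flips r_a r_b r_c: if a = b they collapse to one flip; if
--     a < b then π r_a r_b = [B̄ A C] still contains y itself and y can not
--     come back; if a > b then π r_a r_b = [B Ā C] has -y as last entry
--     of Ā, which forces c = a and τ = [A B̄ C].

open import Defs
open import Data.Nat using (ℕ; _≤_; _<_; _∸_)
open import Data.Integer using (ℤ)
open import Data.List using (List; head; _++_; length)
open import Data.Maybe using (just)
open import Data.Product using (_×_; ∃-syntax)
open import Function.Bundles using (_⇔_)
open import Relation.Binary.PropositionalEquality using (_≡_)

open import Data.Nat using (zero; suc; _+_; s≤s)
open import Data.Nat.Properties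
  using (+-comm; +-suc; ≤-trans; <⇒≤; <-cmp; <-irrefl; n≮0; m≤n⇒m⊓n≡m; m+n∸n≡m; m∸[m∸n]≡n)
open import Data.Integer using (-_; ∣_∣; +0; +[1+_]; -[1+_])
open import Data.Integer.Properties using (neg-involutive; ∣-i∣≡∣i∣)
open import Data.List using ([]; _∷_; [_]; map; reverse; take; drop)
open import Data.List.Properties
  using (map-++; reverse-++; reverse-map; reverse-involutive; length-map; length-reverse;
         length-++; length-take; length-drop; take++drop≡id; ++-assoc; ∷-injective)
open import Data.List.Relation.Unary.All using (All; _∷_)
import Data.List.Relation.Unary.All.Properties as All
open import Data.List.Relation.Unary.AllPairs using (_∷_)
open import Data.List.Relation.Unary.Unique.Propositional using (Unique)
open import Data.List.Relation.Binary.Permutation.Propositional using (_↭_; ↭-sym; ↭⇒↭ₛ)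
open import Data.List.Relation.Binary.Permutation.Propositional.Properties
  using (++⁺ʳ; ↭-reverse; All-resp-↭; ↭-length)
import Data.List.Relation.Binary.Permutation.Setoid.Properties as SetoidPerm
open import Data.Maybe.Properties using (just-injective)
open import Data.Product using (_,_; proj₁; proj₂)
open import Data.Sum using (inj₁; inj₂)
open import Data.Empty using (⊥-elim)
open import Relation.Binary.PropositionalEquality
  using (_≢_; refl; sym; trans; cong; cong₂; subst; subst₂; setoid; module ≡-Reasoning)
open import Relation.Binary.Definitions using (tri<; tri≈; tri>)
open import Relation.Nullary using (¬_)
open import Function.Bundles using (mk⇔)

open ≡-Reasoning

map-neg-involutive : ∀ X → map -_ (map -_ X) ≡ X
map-neg-involutive []      = refl
map-neg-involutive (x ∷ X) = cong₂ _∷_ (neg-involutive x) (map-neg-involutive X)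

bar-involutive : ∀ X → bar (bar X) ≡ X
bar-involutive X = begin
  map -_ (reverse (map -_ (reverse X)))  ≡⟨ cong (map -_) (reverse-map -_ (reverse X)) ⟨
  map -_ (map -_ (reverse (reverse X)))  ≡⟨ map-neg-involutive (reverse (reverse X)) ⟩
  reverse (reverse X)                    ≡⟨ reverse-involutive X ⟩
  X                                      ∎

bar-++ : ∀ X Y → bar (X ++ Y) ≡ bar Y ++ bar X
bar-++ X Y = trans (cong (map -_) (reverse-++ X Y)) (map-++ -_ (reverse Y) (reverse X))

length-bar : ∀ X → length (bar X) ≡ length X
length-bar X = trans (length-map -_ (reverse X)) (length-reverse X)

bar-∷-++ : ∀ X y A C → X ++ bar (y ∷ A) ++ C ≡ (X ++ bar A) ++ - y ∷ C
bar-∷-++ X y A C = begin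
  X ++ bar (y ∷ A) ++ C        ≡⟨ cong (λ Z → X ++ Z ++ C) (bar-++ [ y ] A) ⟩
  X ++ (bar A ++ [ - y ]) ++ C ≡⟨ cong (X ++_) (++-assoc (bar A) [ - y ] C) ⟩
  X ++ bar A ++ - y ∷ C        ≡⟨ ++-assoc X (bar A) (- y ∷ C) ⟨
  (X ++ bar A) ++ - y ∷ C      ∎

take-length-++ : ∀ (X Y : Window) → take (length X) (X ++ Y) ≡ X
take-length-++ []      Y = refl
take-length-++ (x ∷ X) Y = cong (x ∷_) (take-length-++ X Y)

drop-length-++ : ∀ (X Y : Window) → drop (length X) (X ++ Y) ≡ Y
drop-length-++ []      Y = refl
drop-length-++ (x ∷ X) Y = drop-length-++ X Y

flip-++ : ∀ {k} X Y → length X ≡ k → r k (X ++ Y) ≡ bar X ++ Y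
flip-++ X Y refl = cong₂ (λ P Q → bar P ++ Q) (take-length-++ X Y) (drop-length-++ X Y)

split-at : ∀ k (v : Window) → k ≤ length v → ∃[ P ] ∃[ Q ] (v ≡ P ++ Q × length P ≡ k)
split-at k v k≤ =
  take k v , drop k v , sym (take++drop≡id k v) , trans (length-take k v) (m≤n⇒m⊓n≡m k≤)

split-suffix : ∀ k (v : Window) → k ≤ length v → ∃[ P ] ∃[ Q ] (v ≡ P ++ Q × length Q ≡ k)
split-suffix k v k≤ = take m v , drop m v , sym (take++drop≡id m v) ,
  trans (length-drop m v) (m∸[m∸n]≡n k≤)
  where m = length v ∸ k

split-around : ∀ k (v : Window) → k < length v →
  ∃[ L ] ∃[ z ] ∃[ R ] (v ≡ L ++ z ∷ R × length L ≡ k)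
split-around zero    (z ∷ R) _         = [] , z , R , refl , refl
split-around (suc k) (x ∷ v) (s≤s k<) with split-around k v k<
... | L , z , R , refl , refl = x ∷ L , z , R , refl , refl

flip-involutive : ∀ k (v : Window) → k ≤ length v → r k (r k v) ≡ v
flip-involutive k v k≤ with split-at k v k≤
... | P , Q , refl , |P| = begin
  r k (r k (P ++ Q))  ≡⟨ cong (r k) (flip-++ P Q |P|) ⟩
  r k (bar P ++ Q)    ≡⟨ flip-++ (bar P) Q (trans (length-bar P) |P|) ⟩
  bar (bar P) ++ Q    ≡⟨ cong (_++ Q) (bar-involutive P) ⟩
  P ++ Q              ∎

flip-to-front : ∀ L z R → r (suc (length L)) (L ++ z ∷ R) ≡ - z ∷ bar L ++ R
flip-to-front L z R = begin
  r (suc (length L)) (L ++ z ∷ R)      ≡⟨ cong (r (suc (length L))) (++-assoc L [ z ] R) ⟨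
  r (suc (length L)) ((L ++ [ z ]) ++ R)
    ≡⟨ flip-++ (L ++ [ z ]) R (trans (length-++ L) (+-comm (length L) 1)) ⟩
  bar (L ++ [ z ]) ++ R                ≡⟨ cong (_++ R) (bar-++ L [ z ]) ⟩
  - z ∷ bar L ++ R                     ∎

length-bar-++ : ∀ A B → length (bar A ++ B) ≡ length (A ++ B)
length-bar-++ A B = begin
  length (bar A ++ B)          ≡⟨ length-++ (bar A) ⟩
  length (bar A) + length B    ≡⟨ cong (_+ length B) (length-bar A) ⟩
  length A + length B          ≡⟨ length-++ A ⟨
  length (A ++ B)              ∎

length-++-bar : ∀ A B → length (B ++ bar A) ≡ length (A ++ B)
length-++-bar A B = begin
  length (B ++ bar A)          ≡⟨ length-++ B ⟩
  length B + length (bar A)    ≡⟨ cong (length B +_) (length-bar A) ⟩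
  length B + length A          ≡⟨ +-comm (length B) (length A) ⟩
  length A + length B          ≡⟨ length-++ A ⟨
  length (A ++ B)              ∎

flips-growing : ∀ A B C → r (length (A ++ B)) (r (length A) (A ++ B ++ C)) ≡ bar B ++ A ++ C
flips-growing A B C = begin
  r (length (A ++ B)) (r (length A) (A ++ B ++ C))  ≡⟨ cong (r (length (A ++ B))) (flip-++ A (B ++ C) refl) ⟩
  r (length (A ++ B)) (bar A ++ B ++ C)             ≡⟨ cong (r (length (A ++ B))) (++-assoc (bar A) B C) ⟨
  r (length (A ++ B)) ((bar A ++ B) ++ C)           ≡⟨ flip-++ (bar A ++ B) C (length-bar-++ A B) ⟩
  bar (bar A ++ B) ++ C                             ≡⟨ cong (_++ C) (bar-++ (bar A) B) ⟩
  (bar B ++ bar (bar A)) ++ C                       ≡⟨ cong (λ Z → (bar B ++ Z) ++ C) (bar-involutive A) ⟩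
  (bar B ++ A) ++ C                                 ≡⟨ ++-assoc (bar B) A C ⟩
  bar B ++ A ++ C                                   ∎

flips-shrinking : ∀ A B C → r (length B) (r (length (A ++ B)) (A ++ B ++ C)) ≡ B ++ bar A ++ C
flips-shrinking A B C = begin
  r (length B) (r (length (A ++ B)) (A ++ B ++ C))    ≡⟨ cong (λ v → r (length B) (r (length (A ++ B)) v)) (++-assoc A B C) ⟨
  r (length B) (r (length (A ++ B)) ((A ++ B) ++ C))  ≡⟨ cong (r (length B)) (flip-++ (A ++ B) C refl) ⟩
  r (length B) (bar (A ++ B) ++ C)                    ≡⟨ cong (λ Z → r (length B) (Z ++ C)) (bar-++ A B) ⟩
  r (length B) ((bar B ++ bar A) ++ C)                ≡⟨ cong (r (length B)) (++-assoc (bar B) (bar A) C) ⟩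
  r (length B) (bar B ++ bar A ++ C)                  ≡⟨ flip-++ (bar B) (bar A ++ C) (length-bar B) ⟩
  bar (bar B) ++ bar A ++ C                           ≡⟨ cong (_++ bar A ++ C) (bar-involutive B) ⟩
  B ++ bar A ++ C                                     ∎

flip-block : ∀ A B C → r (length (A ++ B)) (B ++ bar A ++ C) ≡ A ++ bar B ++ C
flip-block A B C = begin
  r (length (A ++ B)) (B ++ bar A ++ C)    ≡⟨ cong (r (length (A ++ B))) (++-assoc B (bar A) C) ⟨
  r (length (A ++ B)) ((B ++ bar A) ++ C)  ≡⟨ flip-++ (B ++ bar A) C (length-++-bar A B) ⟩
  bar (B ++ bar A) ++ C                    ≡⟨ cong (_++ C) (bar-++ B (bar A)) ⟩
  (bar (bar A) ++ bar B) ++ C              ≡⟨ cong (λ Z → (Z ++ bar B) ++ C) (bar-involutive A) ⟩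
  (A ++ bar B) ++ C                        ≡⟨ ++-assoc A (bar B) C ⟩
  A ++ bar B ++ C                          ∎

split-growing : ∀ {a b} (π : Window) → a ≤ b → b ≤ length π →
  ∃[ A ] ∃[ B ] ∃[ C ] (π ≡ A ++ B ++ C × length A ≡ a × length (A ++ B) ≡ b)
split-growing {a} {b} π a≤b b≤ with split-at b π b≤
... | P , C , refl , refl with split-at a P a≤b
...   | A , B , refl , |A| = A , B , C , ++-assoc A B C , |A| , refl

split-shrinking : ∀ {a b} (π : Window) → b ≤ a → a ≤ length π →
  ∃[ A ] ∃[ B ] ∃[ C ] (π ≡ A ++ B ++ C × length B ≡ b × length (A ++ B) ≡ a)
split-shrinking {a} {b} π b≤a a≤ with split-at a π a≤
... | P , C , refl , refl with split-suffix b P b≤a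
...   | A , B , refl , |B| = A , B , C , ++-assoc A B C , |B| , refl

abs-flip : ∀ i (w : Window) → map ∣_∣ (r i w) ↭ map ∣_∣ w
abs-flip i w = subst₂ _↭_ abs-r abs-w (++⁺ʳ (map ∣_∣ Q) (↭-reverse (map ∣_∣ P)))
  where
  P = take i w
  Q = drop i w
  abs-r : reverse (map ∣_∣ P) ++ map ∣_∣ Q ≡ map ∣_∣ (r i w)
  abs-r = begin
    reverse (map ∣_∣ P) ++ map ∣_∣ Q          ≡⟨ cong (_++ map ∣_∣ Q) (reverse-map ∣_∣ P) ⟨
    map ∣_∣ (reverse P) ++ map ∣_∣ Q          ≡⟨ cong (_++ map ∣_∣ Q) (map-abs-neg (reverse P)) ⟨
    map ∣_∣ (bar P) ++ map ∣_∣ Q              ≡⟨ map-++ ∣_∣ (bar P) Q ⟨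
    map ∣_∣ (r i w)                           ∎
    where
    map-abs-neg : ∀ X → map ∣_∣ (map -_ X) ≡ map ∣_∣ X
    map-abs-neg []      = refl
    map-abs-neg (x ∷ X) = cong₂ _∷_ (∣-i∣≡∣i∣ x) (map-abs-neg X)
  abs-w : map ∣_∣ P ++ map ∣_∣ Q ≡ map ∣_∣ w
  abs-w = trans (sym (map-++ ∣_∣ P Q)) (cong (map ∣_∣) (take++drop≡id i w))

InB-flip : ∀ {n} i w → InB n w → InB n (r i w)
InB-flip {n} i w (len , bounds , uniq) = len′ , bounds′ , uniq′
  where
  perm = ↭-sym (abs-flip i w)
  len′ : length (r i w) ≡ n
  len′ = begin
    length (r i w)            ≡⟨ length-map ∣_∣ (r i w) ⟨
    length (map ∣_∣ (r i w))  ≡⟨ ↭-length (abs-flip i w) ⟩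
    length (map ∣_∣ w)        ≡⟨ length-map ∣_∣ w ⟩
    length w                  ≡⟨ len ⟩
    n                         ∎
  InRange : ℕ → Set
  InRange m = 1 ≤ m × m ≤ n
  bounds′ = All.map⁻ {P = InRange} (All-resp-↭ perm (All.map⁺ {P = InRange} bounds))
  uniq′ = SetoidPerm.Unique-resp-↭ (setoid ℕ) (↭⇒↭ₛ perm) uniq

≤-length : ∀ {n k w} → InB n w → k ≤ n → k ≤ length w
≤-length (len , _) k≤n = subst (_ ≤_) (sym len) k≤n

All-middle : ∀ {A : Set} {P : A → Set} X w Y → All P (X ++ w ∷ Y) → P w
All-middle X w Y ps with All.++⁻ʳ X ps
... | pw ∷ _ = pw

unique-position : ∀ {A B : Set} (f : A → B) L z R P w Q →
  Unique (map f (L ++ z ∷ R)) → L ++ z ∷ R ≡ P ++ w ∷ Q → f w ≡ f z →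
  length P ≡ length L × w ≡ z
unique-position f []      z R []      w Q _ refl _ = refl , refl
unique-position f []      z R (p ∷ P) w Q (distinct ∷ _) refl fw≡fz =
  ⊥-elim (All-middle P w Q (All.map⁻ distinct) (sym fw≡fz))
unique-position f (l ∷ L) z R []      w Q (distinct ∷ _) refl fw≡fz =
  ⊥-elim (All-middle L z R (All.map⁻ distinct) fw≡fz)
unique-position f (l ∷ L) z R (p ∷ P) w Q (_ ∷ uniq) eq fw≡fz
  with unique-position f L z R P w Q uniq (proj₂ (∷-injective eq)) fw≡fz
... | |P|≡|L| , w≡z = cong suc |P|≡|L| , w≡z

flip-head-position : ∀ {n c x} L z R → InB n (L ++ z ∷ R) → 1 ≤ c → c ≤ n →
  head (r c (L ++ z ∷ R)) ≡ just x → ∣ x ∣ ≡ ∣ z ∣ → c ≡ suc (length L) × x ≡ - z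
flip-head-position {c = suc k} {x} L z R inB@(_ , _ , uniq) _ c≤n hx |x|≡|z|
  with split-around k (L ++ z ∷ R) (≤-length inB c≤n)
... | P , w , Q , eq , refl = cong suc (proj₁ same) , trans x≡-w (cong -_ (proj₂ same))
  where
  x≡-w : x ≡ - w
  x≡-w = just-injective (trans (sym hx)
    (cong head (trans (cong (r (suc (length P))) eq) (flip-to-front P w Q))))
  same : length P ≡ length L × w ≡ z
  same = unique-position ∣_∣ L z R P w Q uniq eq
    (trans (sym (∣-i∣≡∣i∣ w)) (trans (cong ∣_∣ (sym x≡-w)) |x|≡|z|))

entry-not-self-negating : ∀ {n} X y A → InB n (X ++ y ∷ A) → y ≢ - y
entry-not-self-negating X y A (_ , bounds , _) =
  nonzero y (proj₁ (All-middle X y A bounds))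
  where
  nonzero : ∀ x → 1 ≤ ∣ x ∣ → x ≢ - x
  nonzero +0       ()
  nonzero +[1+ m ] _ ()
  nonzero -[1+ m ] _ ()

-- A flip can not bring to the front an entry y that already occurs, with
-- the same sign, in the window: it would have to equal -y.
flip-cannot-restore : ∀ {n c} X y A → InB n (X ++ y ∷ A) → 1 ≤ c → c ≤ n →
  head (r c (X ++ y ∷ A)) ≢ just y
flip-cannot-restore X y A inB 1≤c c≤n hy =
  entry-not-self-negating X y A inB (proj₂ (flip-head-position X y A inB 1≤c c≤n hy refl))

-- A flip bringing y to the front of [X (yA)‾ C] reverses exactly X (yA)‾,
-- the prefix ending with -y.
flip-restoring-head : ∀ {n c} X y A C → InB n (X ++ bar (y ∷ A) ++ C) → 1 ≤ c → c ≤ n →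
  head (r c (X ++ bar (y ∷ A) ++ C)) ≡ just y → c ≡ length X + length (y ∷ A)
flip-restoring-head {n} {c} X y A C inB 1≤c c≤n hy = begin
  c                                ≡⟨ proj₁ (flip-head-position (X ++ bar A) (- y) C inB′ 1≤c c≤n hy′
                                              (sym (∣-i∣≡∣i∣ y))) ⟩
  suc (length (X ++ bar A))        ≡⟨ cong suc (length-++ X) ⟩
  suc (length X + length (bar A))  ≡⟨ cong (λ m → suc (length X + m)) (length-bar A) ⟩
  suc (length X + length A)        ≡⟨ +-suc (length X) (length A) ⟨
  length X + length (y ∷ A)        ∎
  where
  moved = bar-∷-++ X y A C
  inB′ = subst (InB n) moved inB
  hy′ = subst (λ v → head (r c v) ≡ just y) moved hy

flip-changes-head : ∀ {n i w} → InB n w → 1 ≤ i → i ≤ n → head (r i w) ≢ head w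
flip-changes-head {w = []} (len , _) 1≤i i≤n _ = n≮0 (subst (1 ≤_) (sym len) (≤-trans 1≤i i≤n))
flip-changes-head {w = y ∷ A} inB 1≤i i≤n = flip-cannot-restore [] y A inB 1≤i i≤n

Flip : ℕ → Window → Window → Set
Flip n w u = ∃[ i ] (1 ≤ i × i ≤ n × u ≡ r i w)

-- Since flips are involutions, every edge {w , u} can be oriented from w.
adj⇒flip : ∀ {n w u} → InB n u → Adj n w u → Flip n w u
adj⇒flip _   (i , 1≤i , i≤n , inj₁ u≡wrᵢ) = i , 1≤i , i≤n , u≡wrᵢ
adj⇒flip inB (i , 1≤i , i≤n , inj₂ refl)  =
  i , 1≤i , i≤n , sym (flip-involutive i _ (≤-length inB i≤n))

two-flips-restoring : ∀ {n a b π} → InB n π → 1 ≤ a → a ≤ n → 1 ≤ b → b ≤ n →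
  head (r b (r a π)) ≡ head π → r b (r a π) ≡ π
two-flips-restoring {n} {a} {b} {π} inB 1≤a a≤n 1≤b b≤n hπ
  with split-at a π (≤-length inB a≤n)
... | []      , C , refl , refl = ⊥-elim (n≮0 1≤a)
... | y ∷ A , C , refl , refl with flip-restoring-head [] y A C inB′ 1≤b b≤n hπ′
  where
  flipped : r a π ≡ bar (y ∷ A) ++ C
  flipped = flip-++ (y ∷ A) C refl
  inB′ = subst (InB n) flipped (InB-flip a π inB)
  hπ′ = subst (λ v → head (r b v) ≡ just y) flipped hπ
... | refl = flip-involutive a π (≤-length inB a≤n)

no-short-walk : ∀ {n π τ} → InB n π → head τ ≡ head π → π ≢ τ → ∀ m → m < 3 → ¬ Walk n π τ m
no-short-walk _ _ π≢τ zero _ (here _) = π≢τ refl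
no-short-walk inB hτ _ 1 _ (step _ adj (here inBτ)) with adj⇒flip inBτ adj
... | i , 1≤i , i≤n , refl = flip-changes-head inB 1≤i i≤n hτ
no-short-walk inB hτ π≢τ 2 _ (step _ adj₁ (step inB₁ adj₂ (here inBτ)))
  with adj⇒flip inB₁ adj₁ | adj⇒flip inBτ adj₂
... | a , 1≤a , a≤n , refl | b , 1≤b , b≤n , refl =
  π≢τ (sym (two-flips-restoring inB 1≤a a≤n 1≤b b≤n hτ))
no-short-walk _ _ _ (suc (suc (suc _))) (s≤s (s≤s (s≤s ()))) _

BlockFlip : ℕ → Window → Window → Set
BlockFlip n π τ = ∃[ i ] ∃[ j ] (1 ≤ i × i < j × j ≤ n ×
  τ ≡ r j (r i (r j π)) ×
  (∃[ A ] ∃[ B ] ∃[ C ] (π ≡ A ++ B ++ C × length A ≡ j ∸ i × length B ≡ i ×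
    τ ≡ A ++ bar B ++ C)))

block-flip : ∀ {n} A B C → 1 ≤ length B → length B < length (A ++ B) → length (A ++ B) ≤ n →
  BlockFlip n (A ++ B ++ C) (r (length (A ++ B)) (r (length B) (r (length (A ++ B)) (A ++ B ++ C))))
block-flip A B C 1≤i i<j j≤n = length B , length (A ++ B) , 1≤i , i<j , j≤n , refl ,
  A , B , C , refl , |A| , refl ,
  trans (cong (r (length (A ++ B))) (flips-shrinking A B C)) (flip-block A B C)
  where
  |A| : length A ≡ length (A ++ B) ∸ length B
  |A| = begin
    length A                        ≡⟨ m+n∸n≡m (length A) (length B) ⟨
    length A + length B ∸ length B  ≡⟨ cong (_∸ length B) (length-++ A) ⟨
    length (A ++ B) ∸ length B      ∎

three-flips-restoring : ∀ {n a b c π} → InB n π →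
  1 ≤ a → a ≤ n → 1 ≤ b → b ≤ n → 1 ≤ c → c ≤ n →
  head (r c (r b (r a π))) ≡ head π → BlockFlip n π (r c (r b (r a π)))
three-flips-restoring {n} {a} {b} {c} {π} inB 1≤a a≤n 1≤b b≤n 1≤c c≤n hπ with <-cmp a b
-- a = b: the first two flips cancel and one flip can not restore the head.
... | tri≈ _ refl _ = ⊥-elim (flip-changes-head inB 1≤c c≤n
  (trans (cong (λ v → head (r c v)) (sym (flip-involutive a π (≤-length inB a≤n)))) hπ))
-- a < b: π r_a r_b = [B̄ (yA) C] still contains the first entry y of π.
... | tri< a<b _ _ with split-growing π (<⇒≤ a<b) (≤-length inB b≤n)
...   | []    , B , C , refl , refl , _    = ⊥-elim (n≮0 1≤a)
...   | y ∷ A , B , C , refl , refl , refl =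
  ⊥-elim (flip-cannot-restore (bar B) y (A ++ C) (subst (InB n) growing (InB-flip b _ (InB-flip a π inB)))
    1≤c c≤n (subst (λ v → head (r c v) ≡ just y) growing hπ))
  where growing = flips-growing (y ∷ A) B C
-- a > b: π r_a r_b = [B (yA)‾ C], and the third flip must be r_a.
three-flips-restoring {n} {a} {b} {c} {π} inB _ a≤n 1≤b b≤n 1≤c c≤n hπ | tri> _ _ b<a
  with split-shrinking π (<⇒≤ b<a) (≤-length inB a≤n)
... | []    , B , C , refl , refl , refl = ⊥-elim (<-irrefl refl b<a)
... | y ∷ A , B , C , refl , refl , refl with c≡a
  where
  shrinking = flips-shrinking (y ∷ A) B C
  c≡a : c ≡ length ((y ∷ A) ++ B)
  c≡a = begin
    c                             ≡⟨ flip-restoring-head B y A C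
                                       (subst (InB n) shrinking (InB-flip b _ (InB-flip a π inB))) 1≤c c≤n
                                       (subst (λ v → head (r c v) ≡ just y) shrinking hπ) ⟩
    length B + length (y ∷ A)     ≡⟨ +-comm (length B) (length (y ∷ A)) ⟩
    length (y ∷ A) + length B     ≡⟨ length-++ (y ∷ A) ⟨
    length ((y ∷ A) ++ B)         ∎
... | refl = block-flip (y ∷ A) B C 1≤b b<a a≤n

walk₃⇒block-flip : ∀ {n π τ} → InB n π → head τ ≡ head π → Walk n π τ 3 → BlockFlip n π τ
walk₃⇒block-flip inB hτ (step _ adj₁ (step inB₁ adj₂ (step inB₂ adj₃ (here inBτ))))
  with adj⇒flip inB₁ adj₁ | adj⇒flip inB₂ adj₂ | adj⇒flip inBτ adj₃
... | a , 1≤a , a≤n , refl | b , 1≤b , b≤n , refl | c , 1≤c , c≤n , refl =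
  three-flips-restoring inB 1≤a a≤n 1≤b b≤n 1≤c c≤n hτ

-- π r_j r_i r_j ≠ π: otherwise r_i would fix π r_j.
block-flip-moves : ∀ {n i j π} → InB n π → 1 ≤ i → i ≤ n → j ≤ n → r j (r i (r j π)) ≢ π
block-flip-moves {n} {i} {j} {π} inB 1≤i i≤n j≤n fixed =
  flip-changes-head (InB-flip j π inB) 1≤i i≤n (cong head fixes)
  where
  fixes : r i (r j π) ≡ r j π
  fixes = begin
    r i (r j π)            ≡⟨ flip-involutive j (r i (r j π))
                                (≤-length (InB-flip i _ (InB-flip j π inB)) j≤n) ⟨
    r j (r j (r i (r j π))) ≡⟨ cong (r j) fixed ⟩
    r j π                  ∎

block-flip⇒dist₃ : ∀ {n π τ} → InB n π → InB n τ → head τ ≡ head π → BlockFlip n π τ → Dist n π τ 3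
block-flip⇒dist₃ {π = π} inB inBτ hτ (i , j , 1≤i , i<j , j≤n , τ≡ , _) =
  walk , no-short-walk inB hτ π≢τ
  where
  1≤j = ≤-trans 1≤i (<⇒≤ i<j)
  i≤n = ≤-trans (<⇒≤ i<j) j≤n
  inB₁ = InB-flip j π inB
  walk = step inB (j , 1≤j , j≤n , inj₁ refl)
           (step inB₁ (i , 1≤i , i≤n , inj₁ refl)
             (step (InB-flip i _ inB₁) (j , 1≤j , j≤n , inj₁ τ≡) (here inBτ)))
  π≢τ : π ≢ _
  π≢τ π≡τ = block-flip-moves inB 1≤i i≤n j≤n (sym (trans π≡τ τ≡))

lemma4p3 : (n : ℕ) → 2 ≤ n → (π τ : Window) → InB n π → InB n τ →
    (q : ℤ) → head π ≡ just q → head τ ≡ just q →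
    Dist n π τ 3 ⇔
      (∃[ i ] ∃[ j ] (1 ≤ i × i < j × j ≤ n ×
        τ ≡ r j (r i (r j π)) ×
        (∃[ A ] ∃[ B ] ∃[ C ] (π ≡ A ++ B ++ C × length A ≡ j ∸ i × length B ≡ i ×
          τ ≡ A ++ bar B ++ C))))
lemma4p3 n _ π τ inBπ inBτ q hπ hτ =
  mk⇔ (λ dist → walk₃⇒block-flip inBπ same-head (proj₁ dist))
      (block-flip⇒dist₃ inBπ inBτ same-head)
  where
  same-head : head τ ≡ head π
  same-head = trans hτ (sym hπ)
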